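{- Let $G$ be a finite group and $X,Y\subseteq G$ with $X^G=X$ and $Y^G=Y$. Then $[X,{}_MY]=[[X,G],{}_MY]$.
   Context: $[x,y]=x^{ -1}y^{ -1}xy$; for subsets $[X,Y]=\langle[x,y]:x\in X,y\in Y\rangle$, left-normed for iterated commutators; $[X,{}_kY]$ denotes $[X,Y,\dots,Y]$ with $k$ copies of $Y$. $X^G=\{y^{ -1}xy:x\in X,y\in G\}$. $M=M(G)\in\mathbb{N}$ is fixed such that $[X,{}_MY]=[X,{}_iY]$ for all $i\geq M$ and all $X,Y\subseteq G$ with $X^G=X$, $Y^G=Y$ (e.g. $M=|G|$). -}

module Defs where

open import Level using (Level; Lift)
open import Algebra.Bundles using (Group)
open import Data.Nat using (ℕ; zero; suc)
open import Data.Product using (Σ; ∃; _×_; _,_)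
open import Data.List using (List)
open import Data.List.Relation.Unary.Any using (Any)
open import Relation.Unary using (Pred; _≐_)
open import Data.Unit using (⊤)

module GroupDefs {ℓ : Level} (G : Group ℓ ℓ) where
  open Group G

  comm : Carrier → Carrier → Carrier
  comm x y = ((x ⁻¹ ∙ y ⁻¹) ∙ x) ∙ y

  data ⟨_⟩ (S : Pred Carrier ℓ) : Pred Carrier ℓ where
    gen  : ∀ {x} → S x → ⟨ S ⟩ x
    unit : ⟨ S ⟩ ε
    mul  : ∀ {x y} → ⟨ S ⟩ x → ⟨ S ⟩ y → ⟨ S ⟩ (x ∙ y)
    inv  : ∀ {x} → ⟨ S ⟩ x → ⟨ S ⟩ (x ⁻¹)
    resp : ∀ {x y} → x ≈ y → ⟨ S ⟩ x → ⟨ S ⟩ y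

  [_,_] : Pred Carrier ℓ → Pred Carrier ℓ → Pred Carrier ℓ
  [ X , Y ] = ⟨ (λ z → Σ Carrier λ x → Σ Carrier λ y → X x × Y y × (z ≈ comm x y)) ⟩

  [_,_^_] : Pred Carrier ℓ → ℕ → Pred Carrier ℓ → Pred Carrier ℓ
  [ X , zero  ^ Y ] = X
  [ X , suc k ^ Y ] = [ [ X , k ^ Y ] , Y ]

  conjClosure : Pred Carrier ℓ → Pred Carrier ℓ
  conjClosure X z = Σ Carrier λ x → Σ Carrier λ y → X x × (z ≈ (y ⁻¹ ∙ x) ∙ y)

  Normal : Pred Carrier ℓ → Set ℓ
  Normal X = conjClosure X ≐ X

  Whole : Pred Carrier ℓ
  Whole = λ _ → Lift ℓ ⊤

  Finite : Set ℓ
  Finite = Σ (List Carrier) λ xs → ∀ g → Any (g ≈_) xs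

-- Conjugation is an automorphism, so for normal X and Y the subgroup [X,Y] is
-- normal; by [ab,y] = [a,y]^b [b,y] it then contains [a,y] for every a ∈ ⟨X⟩.
-- As [x,g] = x⁻¹ x^g lies in ⟨X⟩ for normal X, we get [[X,G],Y] ⊆ [X,Y], and
-- peeling off the innermost bracket gives [[X,G],_M Y] ⊆ [X,_M Y].  Conversely
-- [X,_M Y] = [X,_{M+1} Y] = [[X,Y],_M Y] ⊆ [[X,G],_M Y] by stability, which
-- also excludes M = 0 because [∅,∅] contains 1 while ∅ does not.
module Submission where

open import Defs
open import Level using (Level; Lift; lift; lower)
open import Algebra.Bundles using (Group)
open import Data.Nat using (ℕ; _≥_; zero; suc; z≤n)
open import Data.Nat.Properties using (n≤1+n)
open import Data.Product using (_,_; proj₁; proj₂)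
open import Data.Unit using (tt)
open import Data.Empty using (⊥; ⊥-elim)
open import Relation.Nullary using (¬_)
open import Function using (id; _∘_)
open import Relation.Unary using (Pred; _≐_; _⊆_)
import Algebra.Properties.Group as GroupProperties
import Relation.Binary.Reasoning.Setoid as SetoidReasoning
open import Tactic.MonoidSolver using (solve)

module CommutatorIdentities {ℓ : Level} (G : Group ℓ ℓ) where
  open Group G
  open GroupDefs G using (comm)
  open GroupProperties G
  open SetoidReasoning setoid

  conj : Carrier → Carrier → Carrier
  conj g x = (g ⁻¹ ∙ x) ∙ g

  x∙gg⁻¹∙z≈x∙z : ∀ x g z → x ∙ (g ∙ g ⁻¹ ∙ z) ≈ x ∙ z
  x∙gg⁻¹∙z≈x∙z x g z = ∙-congˡ (trans (∙-congʳ (inverseʳ g)) (identityˡ z))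

  conj-ε : ∀ g → conj g ε ≈ ε
  conj-ε g = trans (∙-congʳ (identityʳ _)) (inverseˡ g)

  conj-∙ : ∀ g a b → conj g (a ∙ b) ≈ conj g a ∙ conj g b
  conj-∙ g a b = begin
    g ⁻¹ ∙ (a ∙ b) ∙ g                 ≈⟨ solve monoid ⟩
    g ⁻¹ ∙ a ∙ (b ∙ g)                 ≈⟨ x∙gg⁻¹∙z≈x∙z _ g _ ⟨
    g ⁻¹ ∙ a ∙ (g ∙ g ⁻¹ ∙ (b ∙ g))    ≈⟨ solve monoid ⟩
    conj g a ∙ conj g b                ∎

  conj-⁻¹ : ∀ g a → conj g (a ⁻¹) ≈ conj g a ⁻¹
  conj-⁻¹ g a = begin
    g ⁻¹ ∙ a ⁻¹ ∙ g             ≈⟨ assoc _ _ _ ⟩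
    g ⁻¹ ∙ (a ⁻¹ ∙ g)           ≈⟨ ∙-congˡ (∙-congˡ (⁻¹-involutive g)) ⟨
    g ⁻¹ ∙ (a ⁻¹ ∙ g ⁻¹ ⁻¹)     ≈⟨ ∙-congˡ (⁻¹-anti-homo-∙ _ _) ⟨
    g ⁻¹ ∙ (g ⁻¹ ∙ a) ⁻¹        ≈⟨ ⁻¹-anti-homo-∙ _ _ ⟨
    conj g a ⁻¹                 ∎

  conj-comm : ∀ g x y → conj g (comm x y) ≈ comm (conj g x) (conj g y)
  conj-comm g x y = begin
    conj g (x ⁻¹ ∙ y ⁻¹ ∙ x ∙ y)                                 ≈⟨ conj-∙ g _ _ ⟩
    conj g (x ⁻¹ ∙ y ⁻¹ ∙ x) ∙ conj g y                          ≈⟨ ∙-congʳ (conj-∙ g _ _) ⟩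
    conj g (x ⁻¹ ∙ y ⁻¹) ∙ conj g x ∙ conj g y                   ≈⟨ ∙-congʳ (∙-congʳ (conj-∙ g _ _)) ⟩
    conj g (x ⁻¹) ∙ conj g (y ⁻¹) ∙ conj g x ∙ conj g y          ≈⟨ ∙-congʳ (∙-congʳ (∙-cong (conj-⁻¹ g x) (conj-⁻¹ g y))) ⟩
    comm (conj g x) (conj g y)                                   ∎

  comm≈⁻¹∙conj : ∀ x g → comm x g ≈ x ⁻¹ ∙ conj g x
  comm≈⁻¹∙conj x g = solve monoid

  comm-congˡ : ∀ {x x′} y → x ≈ x′ → comm x y ≈ comm x′ y
  comm-congˡ y x≈x′ = ∙-congʳ (∙-cong (∙-congʳ (⁻¹-cong x≈x′)) x≈x′)

  comm-εˡ : ∀ y → comm ε y ≈ ε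
  comm-εˡ y = begin
    ε ⁻¹ ∙ y ⁻¹ ∙ ε ∙ y    ≈⟨ ∙-congʳ (∙-congʳ (∙-congʳ ε⁻¹≈ε)) ⟩
    ε ∙ y ⁻¹ ∙ ε ∙ y       ≈⟨ solve monoid ⟩
    y ⁻¹ ∙ y               ≈⟨ inverseˡ y ⟩
    ε                      ∎

  comm-∙ˡ : ∀ a b y → comm (a ∙ b) y ≈ conj b (comm a y) ∙ comm b y
  comm-∙ˡ a b y = begin
    (a ∙ b) ⁻¹ ∙ y ⁻¹ ∙ (a ∙ b) ∙ y                    ≈⟨ ∙-congʳ (∙-congʳ (∙-congʳ (⁻¹-anti-homo-∙ a b))) ⟩
    b ⁻¹ ∙ a ⁻¹ ∙ y ⁻¹ ∙ (a ∙ b) ∙ y                   ≈⟨ solve monoid ⟩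
    b ⁻¹ ∙ a ⁻¹ ∙ y ⁻¹ ∙ a ∙ (b ∙ y)                   ≈⟨ x∙gg⁻¹∙z≈x∙z _ y _ ⟨
    b ⁻¹ ∙ a ⁻¹ ∙ y ⁻¹ ∙ a ∙ (y ∙ y ⁻¹ ∙ (b ∙ y))      ≈⟨ solve monoid ⟩
    b ⁻¹ ∙ a ⁻¹ ∙ y ⁻¹ ∙ a ∙ y ∙ (y ⁻¹ ∙ b ∙ y)        ≈⟨ x∙gg⁻¹∙z≈x∙z _ b _ ⟨
    b ⁻¹ ∙ a ⁻¹ ∙ y ⁻¹ ∙ a ∙ y ∙ (b ∙ b ⁻¹ ∙ (y ⁻¹ ∙ b ∙ y))  ≈⟨ solve monoid ⟩
    conj b (comm a y) ∙ comm b y                       ∎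

  comm-⁻¹ˡ : ∀ a y → comm (a ⁻¹) y ≈ conj (a ⁻¹) (comm a y ⁻¹)
  comm-⁻¹ˡ a y = begin
    comm (a ⁻¹) y                 ≈⟨ inverseʳ-unique _ _ conj-comm∙comm≈ε ⟩
    conj (a ⁻¹) (comm a y) ⁻¹     ≈⟨ conj-⁻¹ (a ⁻¹) _ ⟨
    conj (a ⁻¹) (comm a y ⁻¹)     ∎
    where
    conj-comm∙comm≈ε : conj (a ⁻¹) (comm a y) ∙ comm (a ⁻¹) y ≈ ε
    conj-comm∙comm≈ε = begin
      conj (a ⁻¹) (comm a y) ∙ comm (a ⁻¹) y   ≈⟨ comm-∙ˡ a (a ⁻¹) y ⟨
      comm (a ∙ a ⁻¹) y                        ≈⟨ comm-congˡ y (inverseʳ a) ⟩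
      comm ε y                                 ≈⟨ comm-εˡ y ⟩
      ε                                        ∎

module NormalCommutators {ℓ : Level} (G : Group ℓ ℓ) where
  open Group G
  open GroupDefs G
  open CommutatorIdentities G

  ConjClosed : Pred Carrier ℓ → Set ℓ
  ConjClosed S = ∀ g {z} → S z → S (conj g z)

  Normal⇒ConjClosed : ∀ {S} → Normal S → ConjClosed S
  Normal⇒ConjClosed normal g {z} z∈S = proj₁ normal (z , g , z∈S , refl)

  ⟨⟩-least : ∀ {S T} → S ⊆ ⟨ T ⟩ → ⟨ S ⟩ ⊆ ⟨ T ⟩
  ⟨⟩-least S⊆T (gen s)       = S⊆T s
  ⟨⟩-least S⊆T unit          = unit
  ⟨⟩-least S⊆T (mul p q)     = mul (⟨⟩-least S⊆T p) (⟨⟩-least S⊆T q)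
  ⟨⟩-least S⊆T (inv p)       = inv (⟨⟩-least S⊆T p)
  ⟨⟩-least S⊆T (resp x≈y p)  = resp x≈y (⟨⟩-least S⊆T p)

  ⟨⟩-conjClosed : ∀ {S} → ConjClosed S → ConjClosed ⟨ S ⟩
  ⟨⟩-conjClosed closed g (gen s)      = gen (closed g s)
  ⟨⟩-conjClosed closed g unit         = resp (sym (conj-ε g)) unit
  ⟨⟩-conjClosed closed g (mul p q)    =
    resp (sym (conj-∙ g _ _)) (mul (⟨⟩-conjClosed closed g p) (⟨⟩-conjClosed closed g q))
  ⟨⟩-conjClosed closed g (inv p)      = resp (sym (conj-⁻¹ g _)) (inv (⟨⟩-conjClosed closed g p))
  ⟨⟩-conjClosed closed g (resp x≈y p) = resp (∙-congʳ (∙-congˡ x≈y)) (⟨⟩-conjClosed closed g p)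

  [,]-conjClosed : ∀ {X Y} → ConjClosed X → ConjClosed Y → ConjClosed [ X , Y ]
  [,]-conjClosed closedX closedY = ⟨⟩-conjClosed λ where
    g (x , y , x∈X , y∈Y , z≈[x,y]) →
      conj g x , conj g y , closedX g x∈X , closedY g y∈Y ,
      trans (∙-congʳ (∙-congˡ z≈[x,y])) (conj-comm g x y)

  [,]-mono : ∀ {A A′ B B′} → A ⊆ A′ → B ⊆ B′ → [ A , B ] ⊆ [ A′ , B′ ]
  [,]-mono A⊆A′ B⊆B′ = ⟨⟩-least λ (x , y , x∈A , y∈B , z≈[x,y]) → gen (x , y , A⊆A′ x∈A , B⊆B′ y∈B , z≈[x,y])

  [,^]-monoˡ : ∀ {A A′ Y} k → A ⊆ A′ → [ A , k ^ Y ] ⊆ [ A′ , k ^ Y ]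
  [,^]-monoˡ zero    A⊆A′ = A⊆A′
  [,^]-monoˡ (suc k) A⊆A′ = [,]-mono ([,^]-monoˡ k A⊆A′) id

  [,suc^]≐[[,],^] : ∀ {A Y} k → [ A , suc k ^ Y ] ≐ [ [ A , Y ] , k ^ Y ]
  [,suc^]≐[[,],^] zero    = id , id
  [,suc^]≐[[,],^] (suc k) =
    [,]-mono (proj₁ ([,suc^]≐[[,],^] k)) id , [,]-mono (proj₂ ([,suc^]≐[[,],^] k)) id

  module _ {X Y : Pred Carrier ℓ} (closed : ConjClosed [ X , Y ]) where

    comm-⟨⟩ˡ∈[,] : ∀ {a y} → ⟨ X ⟩ a → Y y → [ X , Y ] (comm a y)
    comm-⟨⟩ˡ∈[,] {y = y} (gen a∈X) y∈Y = gen (_ , y , a∈X , y∈Y , refl)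
    comm-⟨⟩ˡ∈[,] {y = y} unit y∈Y = resp (sym (comm-εˡ y)) unit
    comm-⟨⟩ˡ∈[,] {y = y} (mul {a} {b} p q) y∈Y =
      resp (sym (comm-∙ˡ a b y)) (mul (closed b (comm-⟨⟩ˡ∈[,] p y∈Y)) (comm-⟨⟩ˡ∈[,] q y∈Y))
    comm-⟨⟩ˡ∈[,] {y = y} (inv {a} p) y∈Y =
      resp (sym (comm-⁻¹ˡ a y)) (closed (a ⁻¹) (inv (comm-⟨⟩ˡ∈[,] p y∈Y)))
    comm-⟨⟩ˡ∈[,] {y = y} (resp a≈b p) y∈Y = resp (comm-congˡ y a≈b) (comm-⟨⟩ˡ∈[,] p y∈Y)

    [⟨⟩,]⊆[,] : [ ⟨ X ⟩ , Y ] ⊆ [ X , Y ]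
    [⟨⟩,]⊆[,] = ⟨⟩-least λ (a , y , a∈⟨X⟩ , y∈Y , z≈[a,y]) → resp (sym z≈[a,y]) (comm-⟨⟩ˡ∈[,] a∈⟨X⟩ y∈Y)

  [,Whole]⊆⟨⟩ : ∀ {X} → ConjClosed X → [ X , Whole ] ⊆ ⟨ X ⟩
  [,Whole]⊆⟨⟩ closed = ⟨⟩-least λ (x , g , x∈X , _ , z≈[x,g]) →
    resp (sym (trans z≈[x,g] (comm≈⁻¹∙conj x g))) (mul (inv (gen x∈X)) (gen (closed g x∈X)))

  [[,Whole],suc^]⊆[,suc^] : ∀ {X Y} → Normal X → Normal Y → ∀ k →
                            [ [ X , Whole ] , suc k ^ Y ] ⊆ [ X , suc k ^ Y ]
  [[,Whole],suc^]⊆[,suc^] {X} {Y} normalX normalY k =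
    proj₂ ([,suc^]≐[[,],^] k) ∘ [,^]-monoˡ k [[,Whole],]⊆[,] ∘ proj₁ ([,suc^]≐[[,],^] k)
    where
    closedX : ConjClosed X
    closedX = Normal⇒ConjClosed normalX

    closedXY : ConjClosed [ X , Y ]
    closedXY = [,]-conjClosed closedX (Normal⇒ConjClosed normalY)

    [[,Whole],]⊆[,] : [ [ X , Whole ] , Y ] ⊆ [ X , Y ]
    [[,Whole],]⊆[,] = [⟨⟩,]⊆[,] closedXY ∘ [,]-mono ([,Whole]⊆⟨⟩ closedX) id

  [,suc^]⊆[[,Whole],^] : ∀ {X Y} k → [ X , suc k ^ Y ] ⊆ [ [ X , Whole ] , k ^ Y ]
  [,suc^]⊆[[,Whole],^] k = [,^]-monoˡ k ([,]-mono id (λ _ → lift tt)) ∘ proj₁ ([,suc^]≐[[,],^] k)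

  ∅ : Pred Carrier ℓ
  ∅ _ = Lift ℓ ⊥

  ∅-normal : Normal ∅
  ∅-normal = (λ ()) , (λ ())

  ¬∅≐[∅,∅] : ¬ (∅ ≐ [ ∅ , ∅ ])
  ¬∅≐[∅,∅] (_ , [∅,∅]⊆∅) = lower ([∅,∅]⊆∅ unit)

lemma2p2 : {ℓ : Level} (G : Group ℓ ℓ) → let open GroupDefs G in
    Finite → (M : ℕ) →
    (∀ (X Y : Pred (Group.Carrier G) ℓ) → Normal X → Normal Y → ∀ i → i ≥ M → [ X , M ^ Y ] ≐ [ X , i ^ Y ]) →
    (X Y : Pred (Group.Carrier G) ℓ) → Normal X → Normal Y →
    [ X , M ^ Y ] ≐ [ [ X , Whole ] , M ^ Y ]
lemma2p2 G _ zero stable _ _ _ _ =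
  ⊥-elim (¬∅≐[∅,∅] (stable ∅ ∅ ∅-normal ∅-normal 1 z≤n))
  where open NormalCommutators G
lemma2p2 G _ (suc k) stable X Y normalX normalY =
  [,suc^]⊆[[,Whole],^] (suc k) ∘ proj₁ (stable X Y normalX normalY (suc (suc k)) (n≤1+n (suc k))) ,
  [[,Whole],suc^]⊆[,suc^] normalX normalY k
  where open NormalCommutators G
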